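{- For any full binary tree $T$ with $n$ internal nodes and rank $r\ge2$, there is a sequence of at most $2n^3+n^2$ rotations transforming $T$ into a tree of rank $r-1$ such that every intermediate tree in the sequence has rank at most $r$.
   Context: A full binary tree is a rooted ordered tree whose nodes are leaves or internal nodes with exactly two children. A right rotation at an internal node $a$ whose left child $b$ is internal, with $C,D$ the subtrees of $b$ and $E$ the right subtree of $a$, replaces the subtree at $a$ by the tree with root $b$, left subtree $C$, right child $a$ having subtrees $D,E$; a left rotation is its inverse. Rank: a leaf has rank $0$; an internal node with children $v,w$ has rank $\mathrm{rank}(v)+1$ if $\mathrm{rank}(v)=\mathrm{rank}(w)$, else $\max\{\mathrm{rank}(v),\mathrm{rank}(w)\}$; the rank of a tree is the rank of its root. -}

module Defs where

open import Data.Nat using (ℕ; zero; suc; _≤_; _⊔_)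
open import Data.Nat using (_≟_)
open import Relation.Nullary using (yes; no)

data Tree : Set where
  leaf : Tree
  node : Tree → Tree → Tree

internal : Tree → ℕ
internal leaf       = 0
internal (node l r) = suc (internal l Data.Nat.+ internal r)

rank : Tree → ℕ
rank leaf = 0
rank (node v w) with rank v ≟ rank w
... | yes _ = suc (rank v)
... | no  _ = rank v ⊔ rank w

data Rot : Tree → Tree → Set where
  rotR  : ∀ C D E → Rot (node (node C D) E) (node C (node D E))
  rotL  : ∀ C D E → Rot (node C (node D E)) (node (node C D) E)
  inL   : ∀ {l l′} r → Rot l l′ → Rot (node l r) (node l′ r)
  inR   : ∀ l {r r′} → Rot r r′ → Rot (node l r) (node l r′)

data RotSeq (b : ℕ) : ℕ → Tree → Tree → Set where
  done : ∀ {T} → rank T ≤ b → RotSeq b 0 T T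
  step : ∀ {k T U V} → rank T ≤ b → Rot T U → RotSeq b k U V → RotSeq b (suc k) T V

-- Flattening both subtrees recursively and then merging them turns a tree into
-- one of rank at most 1 using at most n² rotations, without the rank ever
-- exceeding its initial value r: a tree of rank ≤ 1 is a path with pendant
-- leaves, and two of them are merged by right rotations along the left one,
-- passing only through trees of rank ≤ 2 ≤ r. A single rotation lowers the
-- rank by at most one, so this descent from r to ≤ 1 passes through a tree of
-- rank exactly r − 1, and the prefix up to it is the required sequence.
module Submission where

open import Defs
open import Data.Nat using (ℕ; _+_; _*_; _^_; _≤_; _∸_)
open import Data.Product using (Σ; _×_)
open import Relation.Binary.PropositionalEquality using (_≡_)

open import Data.Nat using (suc; _⊔_; _⊓_; z≤n; s≤s; s≤s⁻¹; _≟_; _≤?_)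
open import Data.Nat.Properties
open import Data.Nat.Tactic.RingSolver using (solve)
open import Data.List using (_∷_; [])
open import Data.Product using (_,_)
open import Data.Sum using (inj₁; inj₂)
open import Data.Empty using (⊥-elim)
open import Function using (_∘_)
open import Relation.Nullary using (yes; no)
open import Relation.Binary.PropositionalEquality using (refl; sym; trans; cong; subst; subst₂)

infixl 6 _⊕_

_⊕_ : ℕ → ℕ → ℕ
a ⊕ b with a ≟ b
... | yes _ = suc a
... | no  _ = a ⊔ b

rank-node : ∀ v w → rank (node v w) ≡ rank v ⊕ rank w
rank-node v w with rank v ≟ rank w
... | yes _ = refl
... | no  _ = refl

⊕-comm : ∀ a b → a ⊕ b ≡ b ⊕ a
⊕-comm a b with a ≟ b | b ≟ a
... | yes refl | yes _    = refl
... | yes refl | no  b≢a  = ⊥-elim (b≢a refl)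
... | no  a≢b  | yes refl = ⊥-elim (a≢b refl)
... | no  _    | no  _    = ⊔-comm a b

m⊔n≤m⊕n : ∀ a b → a ⊔ b ≤ a ⊕ b
m⊔n≤m⊕n a b with a ≟ b
... | yes refl = ≤-trans (≤-reflexive (⊔-idem a)) (n≤1+n a)
... | no  _    = ≤-refl

m⊕n≤1+m⊔n : ∀ a b → a ⊕ b ≤ suc (a ⊔ b)
m⊕n≤1+m⊔n a b with a ≟ b
... | yes _ = s≤s (m≤m⊔n a b)
... | no  _ = n≤1+n _

1+m⊓n≤m⊕n : ∀ a b → suc (a ⊓ b) ≤ a ⊕ b
1+m⊓n≤m⊕n a b with a ≟ b
... | yes _   = s≤s (m⊓n≤m a b)
... | no  a≢b with ≤-total a b
...   | inj₁ a≤b = subst₂ _≤_ (cong suc (sym (m≤n⇒m⊓n≡m a≤b))) (sym (m≤n⇒m⊔n≡n a≤b))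
                     (≤∧≢⇒< a≤b a≢b)
...   | inj₂ b≤a = subst₂ _≤_ (cong suc (sym (m≥n⇒m⊓n≡n b≤a))) (sym (m≥n⇒m⊔n≡m b≤a))
                     (≤∧≢⇒< b≤a (λ b≡a → a≢b (sym b≡a)))

⊕-mono-≤ : ∀ {a a′ b b′} → a ≤ a′ → b ≤ b′ → a ⊕ b ≤ a′ ⊕ b′
⊕-mono-≤ {a} {a′} {b} {b′} a≤a′ b≤b′ with a ≟ b
... | yes refl = ≤-trans (s≤s (⊓-glb a≤a′ b≤b′)) (1+m⊓n≤m⊕n a′ b′)
... | no  _    = ≤-trans (⊔-mono-≤ a≤a′ b≤b′) (m⊔n≤m⊕n a′ b′)

1+m⊕n≤1+[m⊕n] : ∀ a b → suc a ⊕ b ≤ suc (a ⊕ b)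
1+m⊕n≤1+[m⊕n] a b with suc a ≟ b
... | yes refl = s≤s (≤-trans (≤-reflexive (sym (m≤n⇒m⊔n≡n (n≤1+n a)))) (m⊔n≤m⊕n a (suc a)))
... | no  _    = ≤-trans (⊔-lub (s≤s (m≤m⊔n a b)) (≤-trans (m≤n⊔m a b) (n≤1+n _)))
                         (s≤s (m⊔n≤m⊕n a b))

⊕-sucˡ-≤ : ∀ {a a′} b → a ≤ suc a′ → a ⊕ b ≤ suc (a′ ⊕ b)
⊕-sucˡ-≤ {a′ = a′} b a≤1+a′ = ≤-trans (⊕-mono-≤ a≤1+a′ (≤-refl {b})) (1+m⊕n≤1+[m⊕n] a′ b)

⊕-sucʳ-≤ : ∀ a {b b′} → b ≤ suc b′ → a ⊕ b ≤ suc (a ⊕ b′)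
⊕-sucʳ-≤ a {b} {b′} b≤1+b′ = subst₂ (λ x y → x ≤ suc y) (⊕-comm b a) (⊕-comm b′ a)
                                    (⊕-sucˡ-≤ a b≤1+b′)

m⊔n⊔o≤[m⊕n]⊕o : ∀ a b c → a ⊔ b ⊔ c ≤ a ⊕ b ⊕ c
m⊔n⊔o≤[m⊕n]⊕o a b c = ≤-trans (⊔-monoˡ-≤ c (m⊔n≤m⊕n a b)) (m⊔n≤m⊕n _ c)

m⊔n⊔o≤m⊕[n⊕o] : ∀ a b c → a ⊔ b ⊔ c ≤ a ⊕ (b ⊕ c)
m⊔n⊔o≤m⊕[n⊕o] a b c = ≤-trans (≤-reflexive (⊔-assoc a b c))
                                (≤-trans (⊔-monoʳ-≤ a (m⊔n≤m⊕n b c)) (m⊔n≤m⊕n a _))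

[m⊕n]⊕o≤1+m⊔n⊔o : ∀ a b c → a ⊕ b ⊕ c ≤ suc (a ⊔ b ⊔ c)
[m⊕n]⊕o≤1+m⊔n⊔o a b c with a ≟ b
... | no  _    = m⊕n≤1+m⊔n (a ⊔ b) c
... | yes refl with suc a ≟ c
...   | yes refl = s≤s (m≤n⊔m (a ⊔ a) (suc a))
...   | no  _    = ⊔-lub (s≤s (≤-trans (m≤m⊔n a a) (m≤m⊔n _ c)))
                         (≤-trans (m≤n⊔m (a ⊔ a) c) (n≤1+n _))

m⊕[n⊕o]≤1+m⊔n⊔o : ∀ a b c → a ⊕ (b ⊕ c) ≤ suc (a ⊔ b ⊔ c)
m⊕[n⊕o]≤1+m⊔n⊔o a b c = subst₂ (λ x y → x ≤ suc y) mirror⊕ mirror⊔ ([m⊕n]⊕o≤1+m⊔n⊔o c b a)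
  where
  mirror⊕ : c ⊕ b ⊕ a ≡ a ⊕ (b ⊕ c)
  mirror⊕ = trans (⊕-comm (c ⊕ b) a) (cong (a ⊕_) (⊕-comm c b))
  mirror⊔ : c ⊔ b ⊔ a ≡ a ⊔ b ⊔ c
  mirror⊔ = trans (⊔-comm (c ⊔ b) a) (trans (cong (a ⊔_) (⊔-comm c b)) (sym (⊔-assoc a b c)))

rank-node-≤ : ∀ v w {b c} → rank v ≤ b → rank w ≤ c → rank (node v w) ≤ b ⊕ c
rank-node-≤ v w v≤b w≤c = subst (_≤ _) (sym (rank-node v w)) (⊕-mono-≤ v≤b w≤c)

rank-≤-nodeˡ : ∀ A B → rank A ≤ rank (node A B)
rank-≤-nodeˡ A B = subst (rank A ≤_) (sym (rank-node A B))
                         (≤-trans (m≤m⊔n _ _) (m⊔n≤m⊕n (rank A) (rank B)))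

rank-≤-nodeʳ : ∀ A B → rank B ≤ rank (node A B)
rank-≤-nodeʳ A B = subst (rank B ≤_) (sym (rank-node A B))
                         (≤-trans (m≤n⊔m _ _) (m⊔n≤m⊕n (rank A) (rank B)))

1≤rank-node : ∀ A B → 1 ≤ rank (node A B)
1≤rank-node A B = subst (1 ≤_) (sym (rank-node A B)) (≤-trans (s≤s z≤n) (1+m⊓n≤m⊕n (rank A) (rank B)))

2≤rank-node-node : ∀ A B C D → 2 ≤ rank (node (node A B) (node C D))
2≤rank-node-node A B C D =
  subst (2 ≤_) (sym (rank-node (node A B) (node C D)))
        (≤-trans (s≤s (⊓-glb (1≤rank-node A B) (1≤rank-node C D))) (1+m⊓n≤m⊕n _ _))

rank-[node]-node : ∀ C D E → rank (node (node C D) E) ≡ rank C ⊕ rank D ⊕ rank E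
rank-[node]-node C D E = trans (rank-node (node C D) E) (cong (_⊕ rank E) (rank-node C D))

rank-node-[node] : ∀ C D E → rank (node C (node D E)) ≡ rank C ⊕ (rank D ⊕ rank E)
rank-node-[node] C D E = trans (rank-node C (node D E)) (cong (rank C ⊕_) (rank-node D E))

rank-Rot : ∀ {T U} → Rot T U → rank T ≤ suc (rank U)
rank-Rot (rotR C D E) rewrite rank-[node]-node C D E | rank-node-[node] C D E =
  ≤-trans ([m⊕n]⊕o≤1+m⊔n⊔o (rank C) (rank D) (rank E)) (s≤s (m⊔n⊔o≤m⊕[n⊕o] (rank C) (rank D) (rank E)))
rank-Rot (rotL C D E) rewrite rank-[node]-node C D E | rank-node-[node] C D E =
  ≤-trans (m⊕[n⊕o]≤1+m⊔n⊔o (rank C) (rank D) (rank E)) (s≤s (m⊔n⊔o≤[m⊕n]⊕o (rank C) (rank D) (rank E)))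
rank-Rot (inL {l} {l′} r ρ) rewrite rank-node l r | rank-node l′ r = ⊕-sucˡ-≤ (rank r) (rank-Rot ρ)
rank-Rot (inR l {r} {r′} ρ) rewrite rank-node l r | rank-node l r′ = ⊕-sucʳ-≤ (rank l) (rank-Rot ρ)

internal-Rot : ∀ {T U} → Rot T U → internal T ≡ internal U
internal-Rot (rotR C D E) = cong suc (trans (cong suc (+-assoc (internal C) (internal D) (internal E)))
                                            (sym (+-suc (internal C) _)))
internal-Rot (rotL C D E) = sym (internal-Rot (rotR C D E))
internal-Rot (inL r ρ)    = cong (λ i → suc (i + internal r)) (internal-Rot ρ)
internal-Rot (inR l ρ)    = cong (λ i → suc (internal l + i)) (internal-Rot ρ)

RotSeq-internal : ∀ {b k T U} → RotSeq b k T U → internal T ≡ internal U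
RotSeq-internal (done _)     = refl
RotSeq-internal (step _ ρ σ) = trans (internal-Rot ρ) (RotSeq-internal σ)

RotSeq-rank-last : ∀ {b k T U} → RotSeq b k T U → rank U ≤ b
RotSeq-rank-last (done U≤b)   = U≤b
RotSeq-rank-last (step _ _ σ) = RotSeq-rank-last σ

RotSeq-mono : ∀ {b b′ k T U} → b ≤ b′ → RotSeq b k T U → RotSeq b′ k T U
RotSeq-mono b≤b′ (done T≤b)   = done (≤-trans T≤b b≤b′)
RotSeq-mono b≤b′ (step T≤b ρ σ) = step (≤-trans T≤b b≤b′) ρ (RotSeq-mono b≤b′ σ)

RotSeq-++ : ∀ {b k m T U V} → RotSeq b k T U → RotSeq b m U V → RotSeq b (k + m) T V
RotSeq-++ (done _)       τ = τ
RotSeq-++ (step T≤b ρ σ) τ = step T≤b ρ (RotSeq-++ σ τ)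

RotSeq-inL : ∀ {b k T U} r → RotSeq b k T U → RotSeq (b ⊕ rank r) k (node T r) (node U r)
RotSeq-inL r (done {T} T≤b)         = done (rank-node-≤ T r T≤b ≤-refl)
RotSeq-inL r (step {T = T} T≤b ρ σ) = step (rank-node-≤ T r T≤b ≤-refl) (inL r ρ) (RotSeq-inL r σ)

RotSeq-inR : ∀ {b k T U} l → RotSeq b k T U → RotSeq (rank l ⊕ b) k (node l T) (node l U)
RotSeq-inR l (done {T} T≤b)         = done (rank-node-≤ l T ≤-refl T≤b)
RotSeq-inR l (step {T = T} T≤b ρ σ) = step (rank-node-≤ l T ≤-refl T≤b) (inR l ρ) (RotSeq-inR l σ)

record Reach (b m : ℕ) (P : Tree → Set) (T : Tree) : Set where
  constructor reach
  field
    {steps}   : ℕ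
    {target}  : Tree
    steps≤    : steps ≤ m
    target-P  : P target
    rotations : RotSeq b steps T target

RankAtMost : ℕ → Tree → Set
RankAtMost m T = rank T ≤ m

RotSeq-hits-rank : ∀ {b k T U} m → RotSeq b k T U → m ≤ rank T → rank U ≤ m →
                   Reach b k (λ V → rank V ≡ m) T
RotSeq-hits-rank m (done T≤b) m≤T T≤m = reach z≤n (≤-antisym T≤m m≤T) (done T≤b)
RotSeq-hits-rank {T = T} m (step T≤b ρ σ) m≤T U≤m with rank T ≟ m
... | yes T≡m = reach z≤n T≡m (done T≤b)
... | no  T≢m with RotSeq-hits-rank m σ (s≤s⁻¹ (≤-trans (≤∧≢⇒< m≤T (T≢m ∘ sym)) (rank-Rot ρ))) U≤m
...   | reach k≤ V≡m σ′ = reach (s≤s k≤) V≡m (step T≤b ρ σ′)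

merge : ∀ A B → rank A ≤ 1 → rank B ≤ 1 → Reach 2 (internal A) (RankAtMost 1) (node A B)
merge leaf B A≤1 B≤1 = reach z≤n (rank-node-≤ leaf B (z≤n {0}) B≤1) (done (rank-node-≤ leaf B A≤1 B≤1))
merge (node leaf A₂) B A≤1 B≤1 with merge A₂ B (≤-trans (rank-≤-nodeʳ leaf A₂) A≤1) B≤1
... | reach {target = X} k≤ X≤1 σ =
  reach (s≤s k≤) (rank-node-≤ leaf X (z≤n {0}) X≤1)
        (step (rank-node-≤ (node leaf A₂) B A≤1 B≤1) (rotR leaf A₂ B) (RotSeq-inR leaf σ))
merge (node (node C D) leaf) B A≤1 B≤1
  with merge (node C D) (node leaf B) (≤-trans (rank-≤-nodeˡ (node C D) leaf) A≤1)
             (rank-node-≤ leaf B (z≤n {0}) B≤1)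
... | reach k≤ X≤1 σ =
  reach (s≤s (≤-trans k≤ (m≤m+n _ 0))) X≤1
        (step (rank-node-≤ (node (node C D) leaf) B A≤1 B≤1) (rotR (node C D) leaf B) σ)
merge (node (node C D) (node E F)) B A≤1 B≤1 =
  ⊥-elim (1+n≰n (≤-trans (2≤rank-node-node C D E F) A≤1))

m*m+[n*n+m]≤[1+m+n]*[1+m+n] : ∀ m n → m * m + (n * n + m) ≤ (1 + m + n) * (1 + m + n)
m*m+[n*n+m]≤[1+m+n]*[1+m+n] m n =
  ≤-trans (m≤m+n _ (1 + m + 2 * n + 2 * m * n)) (≤-reflexive (sym expand))
  where
  expand : (1 + m + n) * (1 + m + n) ≡ m * m + (n * n + m) + (1 + m + 2 * n + 2 * m * n)
  expand = solve (m ∷ n ∷ [])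

flatten : ∀ T → Reach (rank T) (internal T * internal T) (RankAtMost 1) T
flatten leaf = reach z≤n z≤n (done z≤n)
flatten (node L R) with rank (node L R) ≤? 1
... | yes T≤1 = reach z≤n T≤1 (done ≤-refl)
... | no  T≰1 with flatten L | flatten R
... | reach {k₁} {L′} k₁≤ L′≤1 σ₁ | reach {k₂} {R′} k₂≤ R′≤1 σ₂ with merge L′ R′ L′≤1 R′≤1
... | reach {k₃} k₃≤ X≤1 σ₃ =
  reach count X≤1 (RotSeq-++ flattenL (RotSeq-++ flattenR (RotSeq-mono (≰⇒> T≰1) σ₃)))
  where
  L⊕R≤T : rank L ⊕ rank R ≤ rank (node L R)
  L⊕R≤T = ≤-reflexive (sym (rank-node L R))
  flattenL : RotSeq (rank (node L R)) k₁ (node L R) (node L′ R)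
  flattenL = RotSeq-mono L⊕R≤T (RotSeq-inL R σ₁)
  flattenR : RotSeq (rank (node L R)) k₂ (node L′ R) (node L′ R′)
  flattenR = RotSeq-mono (≤-trans (⊕-mono-≤ (RotSeq-rank-last σ₁) ≤-refl) L⊕R≤T) (RotSeq-inR L′ σ₂)
  count : k₁ + (k₂ + k₃) ≤ internal (node L R) * internal (node L R)
  count = ≤-trans (+-mono-≤ k₁≤ (+-mono-≤ k₂≤ (≤-trans k₃≤ (≤-reflexive (sym (RotSeq-internal σ₁))))))
                  (m*m+[n*n+m]≤[1+m+n]*[1+m+n] (internal L) (internal R))

lemma8 : (T : Tree) → (n r : ℕ) → internal T ≡ n → rank T ≡ r → 2 ≤ r →
    Σ ℕ λ k → Σ Tree λ T′ →
    (k ≤ 2 * n ^ 3 + n ^ 2) × rank T′ ≡ r ∸ 1 × RotSeq r k T T′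
lemma8 T _ _ refl refl 2≤r with flatten T
... | reach k≤n² F≤1 σ with RotSeq-hits-rank (rank T ∸ 1) σ (m∸n≤m _ 1) (≤-trans F≤1 (∸-monoˡ-≤ 1 2≤r))
... | reach k′≤k T′≡r∸1 σ′ = _ , _ , ≤-trans k′≤k (≤-trans k≤n² n*n≤2n³+n²) , T′≡r∸1 , σ′
  where
  n : ℕ
  n = internal T
  n*n≤2n³+n² : n * n ≤ 2 * n ^ 3 + n ^ 2
  n*n≤2n³+n² = ≤-trans (≤-reflexive (cong (n *_) (sym (*-identityʳ n)))) (m≤n+m _ _)
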